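{- There is an algorithm which, given a nonempty partition $\lambda=(\lambda_1,\dots,\lambda_r)$ of $n$ (with $\lambda_1\ge\dots\ge\lambda_r>0$, $\sum_i\lambda_i=n$), computes the Sprague--Grundy value of the Downright game $\mathcal{D}(\lambda)$ using $O(\log r)\le O(\log n)$ time units.
   Context: For a partition $\mu=(\mu_1,\dots,\mu_s)$ and nonnegative integers $i,j$, the subpartition $\mu[i,j]$ is $(\mu_{i+1}-j,\mu_{i+2}-j,\dots)$ with all nonpositive entries removed, if $i<s$ and $j<\mu_{i+1}$; otherwise $\mu[i,j]$ is the empty partition $()$. Downright $\mathcal{D}(\lambda)$ (for nonempty $\lambda$) is the impartial two-player game under normal play (the player unable to move loses) whose positions are nonempty partitions, starting at $\lambda$; from a position $\mu=(\mu_1,\dots,\mu_s)$ one may move to $\mu[1,0]$ if $s>1$, and to $\mu[0,1]$ if $\mu_1>1$. (Equivalently, a piece starting in the top-left box of the Young diagram moves one box down or one box right.) The Sprague--Grundy value is defined recursively by $\mathbb{SG}(A)=\operatorname{mex}\{\mathbb{SG}(B): A\to B\}$, where mex of a finite set of nonnegative integers is the least nonnegative integer not in it. The computational model: the input is the list $\lambda_1,\dots,\lambda_r$; one time unit suffices to read (access) one integer $\lambda_i$, to perform one basic arithmetic operation (addition, subtraction, multiplication or division by 2, parity), or to compute a mex of integers from $\{0,1,2\}$. -}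

module Defs where

open import Data.Nat as ℕ using (ℕ; zero; suc; _≤_; _<_; _≡ᵇ_)
open import Data.Nat.Logarithm using (⌊log₂_⌋)
open import Data.Integer as ℤ using (ℤ; +_; -[1+_])
open import Data.Integer.DivMod using (_/ℕ_; _%ℕ_)
open import Data.List using (List; []; _∷_; length; map; filter)
open import Data.Nat.ListAction using (sum)
open import Data.Bool.ListAction using (any)
open import Data.List.Relation.Unary.All using (All)
open import Data.List.Relation.Unary.Linked using (Linked)
open import Data.Bool using (Bool; true; false; if_then_else_; _∧_)
open import Data.Maybe using (Maybe; just; nothing)
open import Data.Product using (_×_; _,_; Σ; ∃; ∃-syntax)
open import Relation.Binary.PropositionalEquality using (_≡_)
open import Relation.Nullary.Decidable using (⌊_⌋)
open import Data.Nat.Properties using (_≟_)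

record IsNonemptyPartition (λs : List ℕ) : Set where
  field
    nonempty   : 0 < length λs
    positive   : All (0 <_) λs
    decreasing : Linked (λ a b → b ≤ a) λs

down : List ℕ → List ℕ
down []       = []
down (_ ∷ μ)  = μ

-- μ[0,1] : remove the first column (subtract 1, drop nonpositive entries).
right : List ℕ → List ℕ
right μ = filter (λ a → 0 ℕ.<? a) (map ℕ.pred μ)

moves : List ℕ → List (List ℕ)
moves []      = []
moves (a ∷ μ) = movesDown μ ++' movesRight a
  where
    _++'_ : List (List ℕ) → List (List ℕ) → List (List ℕ)
    []       ++' ys = ys
    (x ∷ xs) ++' ys = x ∷ (xs ++' ys)
    movesDown : List ℕ → List (List ℕ)
    movesDown []      = []
    movesDown (b ∷ ν) = (b ∷ ν) ∷ []
    movesRight : ℕ → List (List ℕ)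
    movesRight (suc (suc _)) = right (a ∷ μ) ∷ []
    movesRight _             = []

_∈ᵇ_ : ℕ → List ℕ → Bool
n ∈ᵇ xs = any (λ x → x ≡ᵇ n) xs

mex : List ℕ → ℕ
mex xs = go (length xs) 0
  where
    go : ℕ → ℕ → ℕ
    go zero    n = n
    go (suc k) n = if n ∈ᵇ xs then go k (suc n) else n

-- Every move strictly
-- decreases the number of boxes (sum μ), so fuel = sum μ suffices and
-- SG μ = mex { SG ν : μ → ν } holds for every nonempty partition μ.
sgFuel : ℕ → List ℕ → ℕ
sgFuel zero    μ = 0
sgFuel (suc k) μ = mex (map (sgFuel k) (moves μ))

SG : List ℕ → ℕ
SG μ = sgFuel (sum μ) μ

-- The input list λ is
-- accessible only through the (unit-cost) instruction `read`.  Initially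
-- register 0 holds r = length λ and all other registers hold 0; the output
-- is the content of register 0 when the program halts.

Reg : Set
Reg = ℕ

data Cmd : Set where
  skip   : Cmd
  const  : Reg → ℤ → Cmd
  copy   : Reg → Reg → Cmd
  read   : Reg → Reg → Cmd             -- d := λ_a (0 if a ∉ [1,r])  (1 unit)
  add    : Reg → Reg → Reg → Cmd
  sub    : Reg → Reg → Reg → Cmd
  mul2   : Reg → Reg → Cmd
  div2   : Reg → Reg → Cmd
  parity : Reg → Reg → Cmd
  mex3   : Reg → Reg → Reg → Reg → Cmd -- d := mex{a,b,c}, all ∈ {0,1,2}, else error (1 unit)
  _︔_    : Cmd → Cmd → Cmd
  ifpos  : Reg → Cmd → Cmd → Cmd
  whilepos : Reg → Cmd → Cmd

Env : Set
Env = Reg → ℤ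

update : Env → Reg → ℤ → Env
update σ d v x = if x ≡ᵇ d then v else σ x

-- λ_i (1-based), and 0 outside the range 1..r
nth : List ℕ → ℕ → ℕ
nth []       _             = 0
nth (a ∷ _)  1             = a
nth (_ ∷ as) (suc (suc i)) = nth as (suc i)
nth (_ ∷ _)  zero          = 0

readℤ : List ℕ → ℤ → ℤ
readℤ λs (+ i)    = + nth λs i
readℤ λs -[1+ _ ] = + 0

small : ℤ → Maybe ℕ
small (+ 0) = just 0
small (+ 1) = just 1
small (+ 2) = just 2
small _     = nothing

mex3ℤ : ℤ → ℤ → ℤ → Maybe ℤ
mex3ℤ a b c with small a | small b | small c
... | just x | just y | just z = just (+ mex (x ∷ y ∷ z ∷ []))
... | _      | _      | _      = nothing

isPos : ℤ → Bool
isPos (+ suc _) = true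
isPos _         = false

exec : ℕ → List ℕ → Cmd → Env → Maybe (Env × ℕ)
exec zero    λs _ σ = nothing
exec (suc f) λs skip σ = just (σ , 0)
exec (suc f) λs (const d k) σ = just (update σ d k , 1)
exec (suc f) λs (copy d a) σ = just (update σ d (σ a) , 1)
exec (suc f) λs (read d a) σ = just (update σ d (readℤ λs (σ a)) , 1)
exec (suc f) λs (add d a b) σ = just (update σ d (σ a ℤ.+ σ b) , 1)
exec (suc f) λs (sub d a b) σ = just (update σ d (σ a ℤ.- σ b) , 1)
exec (suc f) λs (mul2 d a) σ = just (update σ d (+ 2 ℤ.* σ a) , 1)
exec (suc f) λs (div2 d a) σ = just (update σ d (σ a /ℕ 2) , 1)
exec (suc f) λs (parity d a) σ = just (update σ d (+ (σ a %ℕ 2)) , 1)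
exec (suc f) λs (mex3 d a b c) σ with mex3ℤ (σ a) (σ b) (σ c)
... | just v  = just (update σ d v , 1)
... | nothing = nothing
exec (suc f) λs (P ︔ Q) σ with exec f λs P σ
... | nothing = nothing
... | just (σ₁ , c₁) with exec f λs Q σ₁
...   | nothing = nothing
...   | just (σ₂ , c₂) = just (σ₂ , c₁ ℕ.+ c₂)
exec (suc f) λs (ifpos a P Q) σ with isPos (σ a)
... | true with exec f λs P σ
...   | nothing = nothing
...   | just (σ₁ , c) = just (σ₁ , suc c)
exec (suc f) λs (ifpos a P Q) σ | false with exec f λs Q σ
...   | nothing = nothing
...   | just (σ₁ , c) = just (σ₁ , suc c)
exec (suc f) λs (whilepos a P) σ with isPos (σ a)
... | false = just (σ , 1)
... | true with exec f λs P σ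
...   | nothing = nothing
...   | just (σ₁ , c₁) with exec f λs (whilepos a P) σ₁
...     | nothing = nothing
...     | just (σ₂ , c₂) = just (σ₂ , suc (c₁ ℕ.+ c₂))

initEnv : List ℕ → Env
initEnv λs zero    = + length λs
initEnv λs (suc _) = + 0

Computes : Cmd → List ℕ → ℕ → ℕ → Set
Computes P λs v c = ∃[ fuel ] ∃[ σ ] ∃[ t ]
  (exec fuel λs P (initEnv λs) ≡ just (σ , t)) × (σ 0 ≡ + v) × (t ℕ.≤ c)

module Submission where

-- A down move followed by a right move reaches the same position as the opposite order, and every
-- position has at most two options, so all values are at most 2.  If the second row has at least two
-- boxes, both options of λ reach λ[1,1], and by induction every option of λ[1,1] has the value of
-- one of them; hence SG λ = mex {SG λ[1,0], SG λ[0,1]} = SG λ[1,1].  Iterating this d − 1 times,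
-- where d is the side of the Durfee square, leaves the hook formed by row d and column d: its arm
-- has λ_d − d + 1 boxes and its leg b − d + 1, where b is the last row of length at least d.  A row
-- or column of k boxes has value (k − 1) mod 2, so the hook's value is a mex of two parities.  Both
-- d (the last i with i ≤ λ_i) and b (the last i with d ≤ λ_i) are found by binary search, with
-- O(log r) probes of the input each.

open import Defs
open import Data.Bool using (true; false; if_then_else_)
open import Data.Bool.Properties using (T-≡)
open import Data.Integer as ℤ using (+_)
open import Data.Integer.Properties using (m-n≡m⊖n; ⊖-≥; ⊖-≤)
open import Data.List using (List; []; _∷_; length; map; replicate)
open import Data.List.Properties using (length-map; map-cong-local)
open import Data.List.Membership.Propositional using (_∈_; _∉_)
open import Data.List.Membership.Propositional.Properties using (∈-map⁺; ∈-map⁻)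
open import Data.List.Relation.Unary.All as All using (All; []; _∷_)
open import Data.List.Relation.Unary.Any as Any using (here; there)
open import Data.List.Relation.Unary.Any.Properties using (any⁺; any⁻)
open import Data.List.Relation.Unary.Linked as Linked using (Linked; []; [-]; _∷_)
open import Data.Maybe using (just)
open import Data.Nat using (ℕ; zero; suc; _+_; _∸_; _*_; _^_; _/_; _⊔_; _≤_; _<_; _≰_; z≤n; s≤s; _%_; ⌊_/2⌋; ⌈_/2⌉)
open import Data.Nat.DivMod using (m%n<n; m/n≡1+[m∸n]/n; m<n*o⇒m/o<n)
open import Data.Nat.ListAction using (sum)
open import Data.Nat.Logarithm using (⌊log₂_⌋; ⌊log₂⌋-mono-≤; ⌊log₂[2^n]⌋≡n)
open import Data.Nat.Tactic.RingSolver using (solve-∀)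
open import Data.Nat.Properties
open import Data.Product using (_×_; _,_; proj₁; proj₂; ∃-syntax)
open import Data.Sum using (_⊎_; inj₁; inj₂)
open import Function using (_∘_; id)
open import Function.Bundles using (Equivalence)
open import Relation.Nullary using (¬_; contradiction; yes; no)
open import Relation.Binary.PropositionalEquality

private
  variable
    a b m n v x y : ℕ
    μ ν w xs : List ℕ

-- mex on short lists

∈ᵇ⇒∈ : (m ∈ᵇ xs) ≡ true → m ∈ xs
∈ᵇ⇒∈ {xs = xs} e = Any.map (λ t → sym (≡ᵇ⇒≡ _ _ t)) (any⁻ _ xs (Equivalence.from T-≡ e))

∈⇒∈ᵇ : m ∈ xs → (m ∈ᵇ xs) ≡ true
∈⇒∈ᵇ m∈ = Equivalence.to T-≡ (any⁺ _ (Any.map (λ eq → ≡⇒≡ᵇ _ _ (sym eq)) m∈))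

-- A copy of the loop of mex, which is hidden in its where-block; the two agree definitionally
-- on lists of known length.
mexLoop : List ℕ → ℕ → ℕ → ℕ
mexLoop xs zero    n = n
mexLoop xs (suc k) n = if n ∈ᵇ xs then mexLoop xs k (suc n) else n

mexLoop-≤ : ∀ xs k n → mexLoop xs k n ≤ n + k
mexLoop-≤ xs zero    n = m≤m+n n 0
mexLoop-≤ xs (suc k) n with n ∈ᵇ xs
... | true  = subst (mexLoop xs k (suc n) ≤_) (sym (+-suc n k)) (mexLoop-≤ xs k (suc n))
... | false = m≤m+n n (suc k)

mexLoop-below : ∀ xs k n → n ≤ m → m < mexLoop xs k n → m ∈ xs
mexLoop-below xs zero    n n≤m m<n = contradiction m<n (≤⇒≯ n≤m)
mexLoop-below xs (suc k) n n≤m m<  with n ∈ᵇ xs in e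
... | false = contradiction m< (≤⇒≯ n≤m)
... | true with m≤n⇒m<n∨m≡n n≤m
...   | inj₁ n<m  = mexLoop-below xs k (suc n) n<m m<
...   | inj₂ refl = ∈ᵇ⇒∈ e

mexLoop-unique : ∀ xs k n {v} → n ≤ v → v ≤ n + k → v ∉ xs → (∀ {m} → m < v → m ∈ xs) →
                 mexLoop xs k n ≡ v
mexLoop-unique xs zero    n n≤v v≤ _ _ = ≤-antisym n≤v (subst (_ ≤_) (+-identityʳ n) v≤)
mexLoop-unique xs (suc k) n {v} n≤v v≤ v∉ below with m≤n⇒m<n∨m≡n n≤v
... | inj₁ n<v rewrite ∈⇒∈ᵇ (below n<v) =
  mexLoop-unique xs k (suc n) n<v (subst (v ≤_) (+-suc n k) v≤) v∉ below
... | inj₂ refl with n ∈ᵇ xs in e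
...   | true  = contradiction (∈ᵇ⇒∈ e) v∉
...   | false = refl

mex≡mexLoop : ∀ xs → length xs ≤ 2 → mex xs ≡ mexLoop xs (length xs) 0
mex≡mexLoop []          _ = refl
mex≡mexLoop (_ ∷ [])     _ = refl
mex≡mexLoop (_ ∷ _ ∷ []) _ = refl
mex≡mexLoop (_ ∷ _ ∷ _ ∷ _) (s≤s (s≤s ()))

mex≤length : ∀ xs → length xs ≤ 2 → mex xs ≤ length xs
mex≤length xs l rewrite mex≡mexLoop xs l = mexLoop-≤ xs (length xs) 0

mex-below : length xs ≤ 2 → m < mex xs → m ∈ xs
mex-below {xs} l rewrite mex≡mexLoop xs l = mexLoop-below xs (length xs) 0 z≤n

mex-unique : length xs ≤ 2 → v ≤ length xs → v ∉ xs → (∀ {m} → m < v → m ∈ xs) → mex xs ≡ v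
mex-unique {xs} l v≤ v∉ below rewrite mex≡mexLoop xs l =
  mexLoop-unique xs (length xs) 0 z≤n v≤ v∉ below

mex∉ᵇ : ∀ xs → length xs ≤ 2 → (mex xs ∈ᵇ xs) ≡ false
mex∉ᵇ []                          _ = refl
mex∉ᵇ (zero ∷ [])                 _ = refl
mex∉ᵇ (suc _ ∷ [])                _ = refl
mex∉ᵇ (zero ∷ zero ∷ [])          _ = refl
mex∉ᵇ (zero ∷ suc zero ∷ [])      _ = refl
mex∉ᵇ (zero ∷ suc (suc _) ∷ [])   _ = refl
mex∉ᵇ (suc zero ∷ zero ∷ [])      _ = refl
mex∉ᵇ (suc (suc _) ∷ zero ∷ [])   _ = refl
mex∉ᵇ (suc _ ∷ suc _ ∷ [])        _ = refl
mex∉ᵇ (_ ∷ _ ∷ _ ∷ _)             (s≤s (s≤s ()))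

mex∉ : length xs ≤ 2 → mex xs ∉ xs
mex∉ {xs} l m∈ with () ← trans (sym (∈⇒∈ᵇ m∈)) (mex∉ᵇ xs l)

-- Partitions, moves and the recursion for SG

Positive : List ℕ → Set
Positive = All (0 <_)

Nonincreasing : List ℕ → Set
Nonincreasing = Linked (λ a b → b ≤ a)

IsPartition : List ℕ → Set
IsPartition μ = Positive μ × Nonincreasing μ

partition-tail : IsPartition (a ∷ μ) → IsPartition μ
partition-tail (_ ∷ p , l) = p , Linked.tail l

right-below-one : Nonincreasing (1 ∷ μ) → Positive μ → right μ ≡ []
right-below-one {μ = []}    _               _              = refl
right-below-one {μ = _ ∷ _} (s≤s z≤n ∷ l) (s≤s z≤n ∷ p) = right-below-one l p

right-positive : ∀ μ → Positive (right μ)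
right-positive []                = []
right-positive (zero ∷ μ)        = right-positive μ
right-positive (suc zero ∷ μ)    = right-positive μ
right-positive (suc (suc _) ∷ μ) = s≤s z≤n ∷ right-positive μ

right-nonincreasing : IsPartition μ → Nonincreasing (right μ)
right-nonincreasing {[]} _ = []
right-nonincreasing {suc zero ∷ μ} (_ ∷ p , l) rewrite right-below-one l p = []
right-nonincreasing {suc (suc _) ∷ []} _ = [-]
right-nonincreasing {suc (suc _) ∷ suc zero ∷ μ} (_ ∷ _ ∷ p , _ ∷ l)
  rewrite right-below-one l p = [-]
right-nonincreasing {suc (suc _) ∷ suc (suc _) ∷ μ} (_ ∷ p , b≤a ∷ l) =
  ≤-pred b≤a ∷ right-nonincreasing (p , l)

right-partition : IsPartition μ → IsPartition (right μ)
right-partition {μ} π = right-positive μ , right-nonincreasing π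

sum-right≤ : ∀ μ → sum (right μ) ≤ sum μ
sum-right≤ []                = z≤n
sum-right≤ (zero ∷ μ)        = sum-right≤ μ
sum-right≤ (suc zero ∷ μ)    = m≤n⇒m≤1+n (sum-right≤ μ)
sum-right≤ (suc (suc a) ∷ μ) = s≤s (+-mono-≤ (n≤1+n a) (sum-right≤ μ))

sum-right< : 0 < a → sum (right (a ∷ μ)) < sum (a ∷ μ)
sum-right< {suc zero}    {μ} _ = s≤s (sum-right≤ μ)
sum-right< {suc (suc a)} {μ} _ = s≤s (+-monoʳ-≤ (suc a) (sum-right≤ μ))

All-moves : (P : List ℕ → Set) → ∀ a μ →
            (∀ {b ν} → μ ≡ b ∷ ν → P (b ∷ ν)) → (∀ {a′} → a ≡ suc (suc a′) → P (right (a ∷ μ))) →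
            All P (moves (a ∷ μ))
All-moves P zero         []      onDown onRight = []
All-moves P (suc zero)    []      onDown onRight = []
All-moves P (suc (suc _)) []      onDown onRight = onRight refl ∷ []
All-moves P zero          (_ ∷ _) onDown onRight = onDown refl ∷ []
All-moves P (suc zero)    (_ ∷ _) onDown onRight = onDown refl ∷ []
All-moves P (suc (suc _)) (_ ∷ _) onDown onRight = onDown refl ∷ onRight refl ∷ []

down∈moves : (b ∷ μ) ∈ moves (a ∷ b ∷ μ)
down∈moves {a = zero}        = here refl
down∈moves {a = suc zero}    = here refl
down∈moves {a = suc (suc _)} = here refl

right∈moves : right (suc (suc a) ∷ μ) ∈ moves (suc (suc a) ∷ μ)
right∈moves {μ = []}    = here refl
right∈moves {μ = _ ∷ _} = there (here refl)

length-moves≤2 : ∀ μ → length (moves μ) ≤ 2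
length-moves≤2 []                    = z≤n
length-moves≤2 (zero ∷ [])           = z≤n
length-moves≤2 (suc zero ∷ [])       = z≤n
length-moves≤2 (suc (suc _) ∷ [])    = s≤s z≤n
length-moves≤2 (zero ∷ _ ∷ _)        = s≤s z≤n
length-moves≤2 (suc zero ∷ _ ∷ _)    = s≤s z≤n
length-moves≤2 (suc (suc _) ∷ _ ∷ _) = s≤s (s≤s z≤n)

moves-decrease : Positive μ → All (λ w → Positive w × sum w < sum μ) (moves μ)
moves-decrease []                     = []
moves-decrease {a ∷ μ} (0<a ∷ pos) = All-moves _ a μ
  (λ { refl → pos , +-monoˡ-≤ (sum μ) 0<a })
  (λ _ → right-positive (a ∷ μ) , sum-right< 0<a)

sgFuel-sufficient : ∀ k k′ → Positive μ → sum μ ≤ k → sum μ ≤ k′ → sgFuel k μ ≡ sgFuel k′ μ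
sgFuel-sufficient {[]}    zero    zero     _   _ _ = refl
sgFuel-sufficient {[]}    zero    (suc _)  _   _ _ = refl
sgFuel-sufficient {[]}    (suc _) zero     _   _ _ = refl
sgFuel-sufficient {[]}    (suc _) (suc _)  _   _ _ = refl
sgFuel-sufficient {_ ∷ _} zero    _       (s≤s _ ∷ _) () _
sgFuel-sufficient {_ ∷ _} (suc _) zero    (s≤s _ ∷ _) _ ()
sgFuel-sufficient {μ@(_ ∷ _)} (suc k) (suc k′) pos μ≤k μ≤k′ =
  cong mex (map-cong-local (All.map stable (moves-decrease pos)))
  where
    stable : ∀ {w} → Positive w × sum w < sum μ → sgFuel k w ≡ sgFuel k′ w
    stable (pos-w , w<μ) =
      sgFuel-sufficient k k′ pos-w (≤-pred (≤-trans w<μ μ≤k)) (≤-pred (≤-trans w<μ μ≤k′))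

SG-rec : Positive μ → SG μ ≡ mex (map SG (moves μ))
SG-rec []                             = refl
SG-rec {suc a ∷ ν} pos@(s≤s _ ∷ _) =
  cong mex (map-cong-local (All.map stable (moves-decrease pos)))
  where
    stable : ∀ {w} → Positive w × sum w < suc a + sum ν → sgFuel (a + sum ν) w ≡ SG w
    stable (pos-w , w<μ) = sgFuel-sufficient _ _ pos-w (≤-pred w<μ) ≤-refl

length-SG-moves≤2 : ∀ μ → length (map SG (moves μ)) ≤ 2
length-SG-moves≤2 μ rewrite length-map SG (moves μ) = length-moves≤2 μ

SG≤2 : Positive μ → SG μ ≤ 2
SG≤2 {μ} pos rewrite SG-rec pos =
  ≤-trans (mex≤length (map SG (moves μ)) (length-SG-moves≤2 μ)) (length-SG-moves≤2 μ)

SG-move≢ : Positive μ → w ∈ moves μ → SG w ≢ SG μ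
SG-move≢ {μ} pos w∈ eq = mex∉ (length-SG-moves≤2 μ)
  (subst (_∈ map SG (moves μ)) (trans eq (SG-rec pos)) (∈-map⁺ SG w∈))

-- The diagonal step

mex-SG-common-move : ∀ {δ ρ ε} → Positive δ → Positive ρ → Positive ε →
                     ε ∈ moves δ → ε ∈ moves ρ → All (λ w → SG w ≡ SG δ ⊎ SG w ≡ SG ρ) (moves ε) →
                     mex (SG δ ∷ SG ρ ∷ []) ≡ SG ε
mex-SG-common-move {δ} {ρ} {ε} pos-δ pos-ρ pos-ε ε∈δ ε∈ρ covered =
  mex-unique (s≤s (s≤s z≤n)) (SG≤2 pos-ε) ε∉ below
  where
    ε∉ : SG ε ∉ SG δ ∷ SG ρ ∷ []
    ε∉ (here eq)         = SG-move≢ pos-δ ε∈δ eq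
    ε∉ (there (here eq)) = SG-move≢ pos-ρ ε∈ρ eq
    below : ∀ {m} → m < SG ε → m ∈ SG δ ∷ SG ρ ∷ []
    below {m} m< with ∈-map⁻ SG (mex-below (length-SG-moves≤2 ε) (subst (m <_) (SG-rec pos-ε) m<))
    ... | w , w∈ , refl with All.lookup covered w∈
    ...   | inj₁ eq = here eq
    ...   | inj₂ eq = there (here eq)

SG-diagonal-≤ : ∀ n x y ν → sum (x ∷ y ∷ ν) ≤ n → IsPartition (x ∷ y ∷ ν) → 2 ≤ y →
                SG (x ∷ y ∷ ν) ≡ SG (right (y ∷ ν))
SG-diagonal-≤ zero    (suc _)       (suc (suc _)) ν ()    _                   _
SG-diagonal-≤ (suc n) x             (suc zero)    ν _     _                   (s≤s ())
SG-diagonal-≤ (suc n) (suc zero)    (suc (suc y)) ν _     (_ , s≤s () ∷ _) _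
SG-diagonal-≤ (suc n) (suc (suc x)) (suc (suc y)) ν (s≤s bound) π@(pos , _) _ =
  trans (SG-rec pos) (mex-SG-common-move (proj₁ π-δ) (proj₁ π-ρ) (right-positive δ)
                        (right∈moves {μ = ν}) down∈moves covered)
  where
    δ ρ : List ℕ
    δ = suc (suc y) ∷ ν
    ρ = suc x ∷ suc y ∷ right ν
    π-δ = partition-tail π
    π-ρ = right-partition π
    δ≤n : sum δ ≤ n
    δ≤n = ≤-trans (m≤n+m (sum δ) (suc x)) bound
    ρ≤n : sum ρ ≤ n
    ρ≤n = ≤-trans (≤-pred (sum-right< {suc (suc x)} {δ} (s≤s z≤n))) bound
    via-down : ∀ {b ν′} → right ν ≡ b ∷ ν′ → SG (b ∷ ν′) ≡ SG δ ⊎ SG (b ∷ ν′) ≡ SG ρ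
    via-down {ν′ = ν′} = inj₁ ∘ diagonal-of-δ ν π-δ δ≤n
      where
        diagonal-of-δ : ∀ ν → IsPartition (suc (suc y) ∷ ν) → sum (suc (suc y) ∷ ν) ≤ n → ∀ {b} →
                  right ν ≡ b ∷ ν′ → SG (b ∷ ν′) ≡ SG (suc (suc y) ∷ ν)
        diagonal-of-δ (suc zero ∷ _) (_ ∷ _ ∷ pos , _ ∷ l) _ eq
          with () ← trans (sym (right-below-one l pos)) eq
        diagonal-of-δ (suc (suc z) ∷ ν″) π″ bound″ eq =
          sym (trans (SG-diagonal-≤ n _ _ ν″ bound″ π″ (s≤s (s≤s z≤n))) (cong SG eq))
    via-right : ∀ {a′} → suc y ≡ suc (suc a′) →
                SG (right (right δ)) ≡ SG δ ⊎ SG (right (right δ)) ≡ SG ρ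
    via-right refl = inj₂ (sym (SG-diagonal-≤ n _ _ (right ν) ρ≤n π-ρ (s≤s (s≤s z≤n))))
    covered = All-moves _ (suc y) (right ν) via-down via-right

SG-diagonal : IsPartition (x ∷ y ∷ ν) → 2 ≤ y → SG (x ∷ y ∷ ν) ≡ SG (right (y ∷ ν))
SG-diagonal = SG-diagonal-≤ _ _ _ _ ≤-refl

-- Hooks

mex[n%2]≡[1+n]%2 : ∀ n → mex (n % 2 ∷ []) ≡ suc n % 2
mex[n%2]≡[1+n]%2 zero          = refl
mex[n%2]≡[1+n]%2 (suc zero)    = refl
mex[n%2]≡[1+n]%2 (suc (suc n)) = mex[n%2]≡[1+n]%2 n

SG-row : ∀ m → SG (suc m ∷ []) ≡ m % 2
SG-row zero    = refl
SG-row (suc m) = begin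
  SG (suc (suc m) ∷ [])     ≡⟨ SG-rec {suc (suc m) ∷ []} (s≤s z≤n ∷ []) ⟩
  mex (SG (suc m ∷ []) ∷ []) ≡⟨ cong (λ v → mex (v ∷ [])) (SG-row m) ⟩
  mex (m % 2 ∷ [])           ≡⟨ mex[n%2]≡[1+n]%2 m ⟩
  suc m % 2                  ∎
  where open ≡-Reasoning

ones-positive : ∀ k → Positive (replicate k 1)
ones-positive zero    = []
ones-positive (suc k) = s≤s z≤n ∷ ones-positive k

right-ones : ∀ k → right (replicate k 1) ≡ []
right-ones zero    = refl
right-ones (suc k) = right-ones k

SG-column : ∀ k → SG (replicate (suc k) 1) ≡ k % 2
SG-column zero    = refl
SG-column (suc k) = begin
  SG (replicate (suc (suc k)) 1)        ≡⟨ SG-rec (ones-positive (suc (suc k))) ⟩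
  mex (SG (replicate (suc k) 1) ∷ [])   ≡⟨ cong (λ v → mex (v ∷ [])) (SG-column k) ⟩
  mex (k % 2 ∷ [])                      ≡⟨ mex[n%2]≡[1+n]%2 k ⟩
  suc k % 2                             ∎
  where open ≡-Reasoning

-- The value left by moving off a hook along a line of x boxes; 2 stands for "no such move", which
-- leaves the mex unchanged because the genuine values are parities.
moveValue : ℕ → ℕ
moveValue (suc (suc x)) = x % 2
moveValue _             = 2

-- The leg's value is repeated only so that the list has the three entries read by mex3.
hookValue : ℕ → ℕ → ℕ
hookValue a k = mex (moveValue a ∷ moveValue k ∷ moveValue k ∷ [])

mex-leg-only : x < 2 → mex (x ∷ []) ≡ mex (2 ∷ x ∷ x ∷ [])
mex-leg-only (s≤s z≤n)       = refl
mex-leg-only (s≤s (s≤s z≤n)) = refl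

mex-arm-only : x < 2 → mex (x ∷ []) ≡ mex (x ∷ 2 ∷ 2 ∷ [])
mex-arm-only (s≤s z≤n)       = refl
mex-arm-only (s≤s (s≤s z≤n)) = refl

mex-arm-leg : x < 2 → y < 2 → mex (y ∷ x ∷ []) ≡ mex (x ∷ y ∷ y ∷ [])
mex-arm-leg (s≤s z≤n)       (s≤s z≤n)       = refl
mex-arm-leg (s≤s z≤n)       (s≤s (s≤s z≤n)) = refl
mex-arm-leg (s≤s (s≤s z≤n)) (s≤s z≤n)       = refl
mex-arm-leg (s≤s (s≤s z≤n)) (s≤s (s≤s z≤n)) = refl

SG-hook : ∀ a k → SG (suc a ∷ replicate k 1) ≡ hookValue (suc a) (suc k)
SG-hook zero    zero    = refl
SG-hook zero    (suc k) = begin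
  SG (replicate (suc (suc k)) 1)       ≡⟨ SG-rec (ones-positive (suc (suc k))) ⟩
  mex (SG (replicate (suc k) 1) ∷ [])  ≡⟨ cong (λ v → mex (v ∷ [])) (SG-column k) ⟩
  mex (k % 2 ∷ [])                     ≡⟨ mex-leg-only (m%n<n k 2) ⟩
  hookValue 1 (suc (suc k))            ∎
  where open ≡-Reasoning
SG-hook (suc a) zero    = begin
  SG (suc (suc a) ∷ [])                ≡⟨ SG-rec {suc (suc a) ∷ []} (s≤s z≤n ∷ []) ⟩
  mex (SG (suc a ∷ []) ∷ [])           ≡⟨ cong (λ v → mex (v ∷ [])) (SG-row a) ⟩
  mex (a % 2 ∷ [])                     ≡⟨ mex-arm-only (m%n<n a 2) ⟩
  hookValue (suc (suc a)) 1            ∎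
  where open ≡-Reasoning
SG-hook (suc a) (suc k) = begin
  SG (suc (suc a) ∷ replicate (suc k) 1)
    ≡⟨ SG-rec (s≤s z≤n ∷ ones-positive (suc k)) ⟩
  mex (SG (replicate (suc k) 1) ∷ SG (suc a ∷ right (replicate k 1)) ∷ [])
    ≡⟨ cong₂ (λ u v → mex (u ∷ v ∷ [])) (SG-column k)
             (trans (cong (λ ν → SG (suc a ∷ ν)) (right-ones k)) (SG-row a)) ⟩
  mex (k % 2 ∷ a % 2 ∷ [])
    ≡⟨ mex-arm-leg (m%n<n a 2) (m%n<n k 2) ⟩
  hookValue (suc (suc a)) (suc (suc k)) ∎
  where open ≡-Reasoning

-- Reduction to a hook along the diagonal

nth-beyond : ∀ l i → length l < i → nth l i ≡ 0
nth-beyond []      i             _         = refl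
nth-beyond (_ ∷ _) zero          _         = refl
nth-beyond (_ ∷ _) (suc zero)    (s≤s ())
nth-beyond (_ ∷ l) (suc (suc i)) (s≤s l<i) = nth-beyond l (suc i) l<i

nth-positive : ∀ l i → Positive l → i < length l → 1 ≤ nth l (suc i)
nth-positive (_ ∷ _) zero    (0<a ∷ _)   _         = 0<a
nth-positive (_ ∷ l) (suc i) (_ ∷ pos) (s≤s i<l) = nth-positive l i pos i<l

nth≤head : ∀ a l i → Nonincreasing (a ∷ l) → nth (a ∷ l) i ≤ a
nth≤head a l       zero          _         = z≤n
nth≤head a l       (suc zero)    _         = ≤-refl
nth≤head a []      (suc (suc i)) _         = z≤n
nth≤head a (b ∷ l) (suc (suc i)) (b≤a ∷ d) = ≤-trans (nth≤head b l (suc i) d) b≤a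

nth-antitone : ∀ l i k → Nonincreasing l → nth l (suc i + k) ≤ nth l (suc i)
nth-antitone []      i       k       _ = z≤n
nth-antitone (a ∷ l) zero    k       d = nth≤head a l (suc k) d
nth-antitone (a ∷ l) (suc i) k       d = nth-antitone l i k (Linked.tail d)

nth-right : ∀ ν i → IsPartition ν → nth (right ν) (suc i) ≡ nth ν (suc i) ∸ 1
nth-right []                 i       _           = refl
nth-right (suc zero ∷ ν)     i       (_ ∷ pos , d)
  rewrite right-below-one d pos = sym (m≤n⇒m∸n≡0 (nth≤head 1 ν (suc i) d))
nth-right (suc (suc _) ∷ ν) zero    _           = refl
nth-right (suc (suc _) ∷ ν) (suc i) π           = nth-right ν i (partition-tail π)

ones-below-two : ∀ ν → IsPartition ν → 2 ≰ nth ν 1 → ν ≡ replicate (length ν) 1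
ones-below-two []                 _ _  = refl
ones-below-two (zero ∷ ν)         (() ∷ _ , _) _
ones-below-two (suc zero ∷ ν)     π _  =
  cong (1 ∷_) (ones-below-two ν (partition-tail π) (<⇒≱ (s≤s (nth≤head 1 ν 2 (proj₂ π)))))
ones-below-two (suc (suc _) ∷ ν) _ ≰2 = contradiction (s≤s (s≤s z≤n)) ≰2

index-of-last-row : ∀ l b → Positive l → 1 ≤ nth l b → 1 ≰ nth l (suc b) → b ≡ length l
index-of-last-row l b pos 1≤b 1≰b+1 = ≤-antisym b≤l l≤b
  where
    b≤l : b ≤ length l
    b≤l with ≤-<-connex b (length l)
    ... | inj₁ b≤l = b≤l
    ... | inj₂ l<b = contradiction (subst (1 ≤_) (nth-beyond l b l<b) 1≤b) λ ()
    l≤b : length l ≤ b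
    l≤b with ≤-<-connex (suc b) (length l)
    ... | inj₁ b<l = contradiction (nth-positive l b pos b<l) 1≰b+1
    ... | inj₂ l≤b = ≤-pred l≤b

nth-after-last : ∀ l → nth l (suc (length l)) ≡ 0
nth-after-last l = nth-beyond l (suc (length l)) ≤-refl

index≤length : ∀ l i → 1 ≤ i → i ≤ nth l i → i ≤ length l
index≤length l i 1≤i i≤λi with ≤-<-connex i (length l)
... | inj₁ i≤l = i≤l
... | inj₂ l<i = contradiction (subst (i ≤_) (nth-beyond l i l<i) i≤λi) (<⇒≱ 1≤i)

≰⇒≰∸1 : suc (suc m) ≰ n → suc m ≰ n ∸ 1
≰⇒≰∸1 {n = zero}  _   ()
≰⇒≰∸1 {n = suc _} ≰n le = ≰n (s≤s le)

SG≡hookValue : ∀ d b l → IsPartition l → 1 ≤ d →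
                    d ≤ nth l d → suc d ≰ nth l (suc d) → d ≤ b → d ≤ nth l b → d ≰ nth l (suc b) →
                    SG l ≡ hookValue (suc (nth l d ∸ d)) (suc (b ∸ d))
SG≡hookValue 1 (suc b) (suc a ∷ ν) π _ _ ≰2 _ 1≤λb 1≰λb+1 = begin
  SG (suc a ∷ ν)                          ≡⟨ cong (λ ν → SG (suc a ∷ ν)) ν-ones ⟩
  SG (suc a ∷ replicate (length ν) 1)     ≡⟨ SG-hook a (length ν) ⟩
  hookValue (suc a) (suc (length ν))      ≡⟨ cong (hookValue (suc a) ∘ suc) (sym b≡) ⟩
  hookValue (suc a) (suc b)               ∎
  where
    open ≡-Reasoning
    ν-ones = ones-below-two ν (partition-tail π) ≰2
    b≡ = suc-injective (index-of-last-row (suc a ∷ ν) (suc b) (proj₁ π) 1≤λb 1≰λb+1)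
SG≡hookValue 1 _ (zero ∷ ν) (() ∷ _ , _) _ _ _ _ _ _
SG≡hookValue (suc (suc d)) (suc (suc b)) l@(x ∷ y ∷ ν) π _ h₁ h₂ (s≤s h₃) h₄ h₅ = begin
  SG l
    ≡⟨ SG-diagonal π 2≤y ⟩
  SG l′
    ≡⟨ SG≡hookValue (suc d) (suc b) l′ π′ (s≤s z≤n) g₁ g₂ h₃ g₄ g₅ ⟩
  hookValue (suc (nth l′ (suc d) ∸ suc d)) (suc (b ∸ d))
    ≡⟨ cong (λ v → hookValue (suc v) (suc (b ∸ d))) arm≡ ⟩
  hookValue (suc (nth l (suc (suc d)) ∸ suc (suc d))) (suc (b ∸ d)) ∎
  where
    open ≡-Reasoning
    l′ = right (y ∷ ν)
    π′ = right-partition (partition-tail π)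
    shift : ∀ i → nth l′ (suc i) ≡ nth l (suc (suc i)) ∸ 1
    shift i = nth-right (y ∷ ν) i (partition-tail π)
    2≤y : 2 ≤ y
    2≤y = ≤-trans (s≤s (s≤s z≤n)) (≤-trans h₁ (nth-antitone l 1 d (proj₂ π)))
    g₁ : suc d ≤ nth l′ (suc d)
    g₁ = subst (suc d ≤_) (sym (shift d)) (∸-monoˡ-≤ 1 h₁)
    g₂ : suc (suc d) ≰ nth l′ (suc (suc d))
    g₂ = subst (suc (suc d) ≰_) (sym (shift (suc d))) (≰⇒≰∸1 h₂)
    g₄ : suc d ≤ nth l′ (suc b)
    g₄ = subst (suc d ≤_) (sym (shift b)) (∸-monoˡ-≤ 1 h₄)
    g₅ : suc d ≰ nth l′ (suc (suc b))
    g₅ = subst (suc d ≰_) (sym (shift (suc b))) (≰⇒≰∸1 h₅)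
    arm≡ : nth l′ (suc d) ∸ suc d ≡ nth l (suc (suc d)) ∸ suc (suc d)
    arm≡ = trans (cong (_∸ suc d) (shift d)) (∸-+-assoc (nth l (suc (suc d))) 1 (suc d))

-- Big-step runs of the machine

data Run (λs : List ℕ) : Cmd → Env → Env → ℕ → Set where
  run-const  : ∀ {σ d k} → Run λs (const d k) σ (update σ d k) 1
  run-copy   : ∀ {σ d a v} → σ a ≡ v → Run λs (copy d a) σ (update σ d v) 1
  run-read   : ∀ {σ d a i} → σ a ≡ + i → Run λs (read d a) σ (update σ d (+ nth λs i)) 1
  run-add    : ∀ {σ d a b x y} → σ a ≡ + x → σ b ≡ + y →
               Run λs (add d a b) σ (update σ d (+ (x + y))) 1
  run-sub    : ∀ {σ d a b x y} → σ a ≡ + x → σ b ≡ + y → y ≤ x →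
               Run λs (sub d a b) σ (update σ d (+ (x ∸ y))) 1
  run-subℤ   : ∀ {σ d a b x y} → σ a ≡ x → σ b ≡ y → Run λs (sub d a b) σ (update σ d (x ℤ.- y)) 1
  run-div2   : ∀ {σ d a x} → σ a ≡ + x → Run λs (div2 d a) σ (update σ d (+ ⌊ x /2⌋)) 1
  run-parity : ∀ {σ d a x} → σ a ≡ + x → Run λs (parity d a) σ (update σ d (+ (x % 2))) 1
  run-mex3   : ∀ {σ d a b c v} → mex3ℤ (σ a) (σ b) (σ c) ≡ just v →
               Run λs (mex3 d a b c) σ (update σ d v) 1
  run-seq    : ∀ {P Q σ σ₁ σ₂ t₁ t₂} → Run λs P σ σ₁ t₁ → Run λs Q σ₁ σ₂ t₂ →
               Run λs (P ︔ Q) σ σ₂ (t₁ + t₂)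
  run-then   : ∀ {a P Q σ σ₁ t} → isPos (σ a) ≡ true → Run λs P σ σ₁ t →
               Run λs (ifpos a P Q) σ σ₁ (suc t)
  run-else   : ∀ {a P Q σ σ₁ t} → isPos (σ a) ≡ false → Run λs Q σ σ₁ t →
               Run λs (ifpos a P Q) σ σ₁ (suc t)
  run-exit   : ∀ {a P σ} → isPos (σ a) ≡ false → Run λs (whilepos a P) σ σ 1
  run-loop   : ∀ {a P σ σ₁ σ₂ t₁ t₂} → isPos (σ a) ≡ true → Run λs P σ σ₁ t₁ →
               Run λs (whilepos a P) σ₁ σ₂ t₂ → Run λs (whilepos a P) σ σ₂ (suc (t₁ + t₂))

n/2≡⌊n/2⌋ : ∀ n → n / 2 ≡ ⌊ n /2⌋
n/2≡⌊n/2⌋ zero          = refl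
n/2≡⌊n/2⌋ (suc zero)    = refl
n/2≡⌊n/2⌋ (suc (suc n)) =
  trans (m/n≡1+[m∸n]/n {suc (suc n)} {2} (s≤s (s≤s z≤n))) (cong suc (n/2≡⌊n/2⌋ n))

depth : ∀ {λs P σ σ′ t} → Run λs P σ σ′ t → ℕ
depth (run-seq r₁ r₂)    = suc (depth r₁ ⊔ depth r₂)
depth (run-then _ r)     = suc (depth r)
depth (run-else _ r)     = suc (depth r)
depth (run-loop _ r₁ r₂) = suc (depth r₁ ⊔ depth r₂)
depth _                  = 0

+-∸-ℤ : y ≤ x → + x ℤ.- + y ≡ + (x ∸ y)
+-∸-ℤ {y} {x} y≤x = trans (m-n≡m⊖n x y) (⊖-≥ y≤x)

Run⇒exec : ∀ {λs P σ σ′ t} (r : Run λs P σ σ′ t) f → depth r ≤ f → exec (suc f) λs P σ ≡ just (σ′ , t)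
Run⇒exec run-const                 f _ = refl
Run⇒exec (run-copy e)              f _ rewrite e = refl
Run⇒exec (run-read e)              f _ rewrite e = refl
Run⇒exec (run-add e₁ e₂)           f _ rewrite e₁ | e₂ = refl
Run⇒exec (run-sub e₁ e₂ y≤x)       f _ rewrite e₁ | e₂ | +-∸-ℤ y≤x = refl
Run⇒exec (run-subℤ e₁ e₂)          f _ rewrite e₁ | e₂ = refl
Run⇒exec (run-div2 {x = x} e)      f _ rewrite e | n/2≡⌊n/2⌋ x = refl
Run⇒exec (run-parity e)            f _ rewrite e = refl
Run⇒exec (run-mex3 e)              f _ rewrite e = refl
Run⇒exec (run-seq r₁ r₂)     (suc f) (s≤s le)
  rewrite Run⇒exec r₁ f (≤-trans (m≤m⊔n _ _) le) | Run⇒exec r₂ f (≤-trans (m≤n⊔m _ _) le) = refl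
Run⇒exec (run-then e r)      (suc f) (s≤s le) rewrite e | Run⇒exec r f le = refl
Run⇒exec (run-else e r)      (suc f) (s≤s le) rewrite e | Run⇒exec r f le = refl
Run⇒exec (run-exit e)              f _ rewrite e = refl
Run⇒exec (run-loop e r₁ r₂)  (suc f) (s≤s le)
  rewrite e | Run⇒exec r₁ f (≤-trans (m≤m⊔n _ _) le) | Run⇒exec r₂ f (≤-trans (m≤n⊔m _ _) le) = refl

Run⇒Computes : ∀ {λs P σ t v c} → Run λs P (initEnv λs) σ t → σ 0 ≡ + v → t ≤ c → Computes P λs v c
Run⇒Computes r out t≤c = suc (depth r) , _ , _ , Run⇒exec r (depth r) ≤-refl , out , t≤c

-- Binary search

isPos-neg : ∀ k → isPos (ℤ.- (+ k)) ≡ false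
isPos-neg zero    = refl
isPos-neg (suc k) = refl

n≤m⇒isPos[1+m-n] : n ≤ m → isPos (+ suc m ℤ.- + n) ≡ true
n≤m⇒isPos[1+m-n] {n} {m} n≤m rewrite +-∸-ℤ (m≤n⇒m≤1+n n≤m) | +-∸-assoc 1 n≤m = refl

m<n⇒isPos[1+m-n] : m < n → isPos (+ suc m ℤ.- + n) ≡ false
m<n⇒isPos[1+m-n] {m} {n} m<n rewrite m-n≡m⊖n (suc m) n | ⊖-≤ m<n = isPos-neg (n ∸ suc m)

⌊n/2⌋<2^k : ∀ n k → n < 2 ^ suc k → ⌊ n /2⌋ < 2 ^ k
⌊n/2⌋<2^k n k n< =
  subst (_< 2 ^ k) (n/2≡⌊n/2⌋ n) (m<n*o⇒m/o<n (subst (n <_) (*-comm 2 (2 ^ k)) n<))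

n∸⌊n/2⌋≡⌈n/2⌉ : ∀ n → n ∸ ⌊ n /2⌋ ≡ ⌈ n /2⌉
n∸⌊n/2⌋≡⌈n/2⌉ n = trans (cong (_∸ ⌊ n /2⌋) (sym (⌊n/2⌋+⌈n/2⌉≡n n))) (m+n∸m≡n ⌊ n /2⌋ ⌈ n /2⌉)

-- With lo in register 1, the width n in register 2 and 1 in register 3, probe
-- mid = lo + ⌈n/2⌉, compare the threshold in register X with λ_mid, and on success move lo to mid;
-- either way the width at least halves.
searchStep : Reg → Cmd
searchStep X = add 4 3 2 ︔ (div2 4 4 ︔ (add 5 1 4 ︔ (read 7 5 ︔ (add 8 3 7 ︔ (sub 8 8 X ︔
               ifpos 8 (copy 1 5 ︔ sub 2 2 4) (sub 2 4 3))))))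

search : Reg → Cmd
search X = whilepos 2 (searchStep X)

-- The search writes only registers 1, 2, 4, 5, 7 and 8; these are the registers used around it.
record Frame (σ σ′ : Env) : Set where
  field
    at0 : σ′ 0 ≡ σ 0
    at3 : σ′ 3 ≡ σ 3
    at6 : σ′ 6 ≡ σ 6
    at9 : σ′ 9 ≡ σ 9

frame-refl : ∀ {σ} → Frame σ σ
frame-refl = record { at0 = refl ; at3 = refl ; at6 = refl ; at9 = refl }

frame-trans : ∀ {σ σ₁ σ₂} → Frame σ σ₁ → Frame σ₁ σ₂ → Frame σ σ₂
frame-trans f g = record
  { at0 = trans (Frame.at0 g) (Frame.at0 f) ; at3 = trans (Frame.at3 g) (Frame.at3 f)
  ; at6 = trans (Frame.at6 g) (Frame.at6 f) ; at9 = trans (Frame.at9 g) (Frame.at9 f) }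

-- The threshold g mid is read from register X after registers 4, 5 (= mid), 7 and 8 have been
-- written, while register 6 holds the parameter c.
module BinarySearch (λs : List ℕ) (X : Reg) (g : ℕ → ℕ) (c : ℕ)
  (threshold : ∀ {σ m v₄ v₄′ v₇ v₈} → σ 6 ≡ + c →
               update (update (update (update (update σ 4 v₄) 4 v₄′) 5 (+ m)) 7 v₇) 8 v₈ X ≡ + g m)
  where

  Holds : ℕ → Set
  Holds i = g i ≤ nth λs i

  -- Holds need not be monotone: the invariant Holds lo, ¬ Holds (lo + n + 1) alone forces the
  -- search to end at some lo with Holds lo and ¬ Holds (lo + 1).
  record Window (σ : Env) (lo n : ℕ) : Set where
    field
      reg-lo    : σ 1 ≡ + lo
      reg-width : σ 2 ≡ + n
      reg-one   : σ 3 ≡ + 1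
      reg-c     : σ 6 ≡ + c
      holds     : Holds lo
      fails     : ¬ Holds (suc (lo + n))

  record Halved (σ : Env) (lo n : ℕ) : Set where
    field
      σ′ : Env
      t lo′ n′ : ℕ
      run    : Run λs (searchStep X) σ σ′ t
      cost   : t ≤ 9
      window : Window σ′ lo′ n′
      frame  : Frame σ σ′
      lo≤lo′ : lo ≤ lo′
      narrow : n′ ≤ ⌊ n /2⌋

  halve : ∀ {σ lo n} → Window σ lo (suc n) → Halved σ lo (suc n)
  halve {σ} {lo} {n} w with g (lo + suc ⌊ n /2⌋) ≤? nth λs (lo + suc ⌊ n /2⌋)
  ... | yes ok = record
    { run    = run-seq (run-add reg-one reg-width) (run-seq (run-div2 refl)
               (run-seq (run-add reg-lo refl) (run-seq (run-read refl) (run-seq (run-add reg-one refl)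
               (run-seq (run-subℤ refl (threshold {σ} reg-c))
               (run-then (n≤m⇒isPos[1+m-n] ok) (run-seq (run-copy refl) (run-sub reg-width refl h≤))))))))
    ; cost   = ≤-refl
    ; window = record { reg-lo = refl ; reg-width = refl ; reg-one = reg-one ; reg-c = reg-c
                      ; holds = ok ; fails = subst (¬_ ∘ Holds ∘ suc) (sym end≡) fails }
    ; frame  = record { at0 = refl ; at3 = refl ; at6 = refl ; at9 = refl }
    ; lo≤lo′ = m≤m+n lo _
    ; narrow = ≤-reflexive (n∸⌊n/2⌋≡⌈n/2⌉ n) }
    where
      open Window w
      h≤ : suc ⌊ n /2⌋ ≤ suc n
      h≤ = s≤s (⌊n/2⌋≤n n)
      end≡ : lo + suc ⌊ n /2⌋ + (suc n ∸ suc ⌊ n /2⌋) ≡ lo + suc n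
      end≡ = trans (+-assoc lo _ _) (cong (λ k → lo + k) (m+[n∸m]≡n h≤))
  ... | no fail = record
    { run    = run-seq (run-add reg-one reg-width) (run-seq (run-div2 refl)
               (run-seq (run-add reg-lo refl) (run-seq (run-read refl) (run-seq (run-add reg-one refl)
               (run-seq (run-subℤ refl (threshold {σ} reg-c))
               (run-else (m<n⇒isPos[1+m-n] (≰⇒> fail)) (run-sub refl reg-one (s≤s z≤n))))))))
    ; cost   = m≤n⇒m≤1+n ≤-refl
    ; window = record { reg-lo = reg-lo ; reg-width = refl ; reg-one = reg-one ; reg-c = reg-c
                      ; holds = holds ; fails = subst (¬_ ∘ Holds) (+-suc lo ⌊ n /2⌋) fail }
    ; frame  = record { at0 = refl ; at3 = refl ; at6 = refl ; at9 = refl }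
    ; lo≤lo′ = ≤-refl
    ; narrow = ⌊n/2⌋-mono (n≤1+n n) }
    where open Window w

  record Found (σ : Env) (lo k : ℕ) : Set where
    field
      σ′ : Env
      t lo′ : ℕ
      run    : Run λs (search X) σ σ′ t
      cost   : t ≤ 10 * k + 1
      reg-lo : σ′ 1 ≡ + lo′
      holds  : Holds lo′
      fails  : ¬ Holds (suc lo′)
      frame  : Frame σ σ′
      lo≤lo′ : lo ≤ lo′

  search-finds : ∀ k {σ lo n} → n < 2 ^ k → Window σ lo n → Found σ lo k
  search-finds k {lo = lo} {zero} _ w = record
    { run = run-exit (cong isPos reg-width) ; cost = m≤n+m 1 (10 * k) ; reg-lo = reg-lo
    ; holds = holds ; fails = subst (¬_ ∘ Holds ∘ suc) (+-identityʳ lo) fails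
    ; frame = frame-refl ; lo≤lo′ = ≤-refl }
    where open Window w
  search-finds zero    {n = suc _} (s≤s ()) _
  search-finds (suc k) {n = suc n} n< w = record
    { run = run-loop (cong isPos (Window.reg-width w)) H.run F.run
    ; cost = ≤-trans (s≤s (+-mono-≤ H.cost F.cost)) (≤-reflexive (sym cost≡))
    ; reg-lo = F.reg-lo ; holds = F.holds ; fails = F.fails
    ; frame = frame-trans H.frame F.frame ; lo≤lo′ = ≤-trans H.lo≤lo′ F.lo≤lo′ }
    where
      module H = Halved (halve w)
      module F = Found (search-finds k (≤-<-trans H.narrow (⌊n/2⌋<2^k (suc n) k n<)) H.window)
      cost≡ : 10 * suc k + 1 ≡ suc (9 + (10 * k + 1))
      cost≡ = trans (cong (_+ 1) (*-suc 10 k)) (+-assoc 10 (10 * k) 1)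

-- The program

small-≤2 : x ≤ 2 → small (+ x) ≡ just x
small-≤2 z≤n             = refl
small-≤2 (s≤s z≤n)       = refl
small-≤2 (s≤s (s≤s z≤n)) = refl

mex3ℤ-≤2 : x ≤ 2 → y ≤ 2 → m ≤ 2 → mex3ℤ (+ x) (+ y) (+ m) ≡ just (+ mex (x ∷ y ∷ m ∷ []))
mex3ℤ-≤2 x≤2 y≤2 m≤2 rewrite small-≤2 x≤2 | small-≤2 y≤2 | small-≤2 m≤2 = refl

moveValue≤2 : ∀ x → moveValue x ≤ 2
moveValue≤2 zero          = ≤-refl
moveValue≤2 (suc zero)    = ≤-refl
moveValue≤2 (suc (suc x)) = <⇒≤ (m%n<n x 2)

n<2^suc⌊log₂n⌋ : ∀ n → n < 2 ^ suc ⌊log₂ n ⌋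
n<2^suc⌊log₂n⌋ n with <-≤-connex n (2 ^ suc ⌊log₂ n ⌋)
... | inj₁ n< = n<
... | inj₂ 2^≤n = contradiction (subst (_≤ ⌊log₂ n ⌋) (⌊log₂[2^n]⌋≡n _) (⌊log₂⌋-mono-≤ 2^≤n)) (n≮n _)

-- Register 3 := 1 and the window lo = 1, n = r − 1 of the search for the side d of the Durfee square.
setup : Cmd
setup = const 3 (+ 1) ︔ (const 1 (+ 1) ︔ sub 2 0 3)

-- Registers 6 := d, 9 := 1 + λ_d − d and the window lo = d, n = r − d of the search for the last
-- row of length at least d.
measureArm : Cmd
measureArm = copy 6 1 ︔ (read 7 6 ︔ (sub 9 7 6 ︔ (add 9 3 9 ︔ sub 2 0 6)))

moveValueCmd : Reg → Reg → Cmd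
moveValueCmd s t = sub 13 s 3 ︔ ifpos 13 (parity t s) (const t (+ 2))

finish : Cmd
finish = sub 10 1 6 ︔ (add 10 3 10 ︔ (moveValueCmd 9 11 ︔ (moveValueCmd 10 12 ︔ mex3 0 11 12 12)))

sgProgram : Cmd
sgProgram = setup ︔ (search 5 ︔ (measureArm ︔ (search 6 ︔ finish)))

module DurfeeSearch (λs : List ℕ) = BinarySearch λs 5 id 0 (λ _ → refl)
module LegSearch (λs : List ℕ) (d : ℕ) = BinarySearch λs 6 (λ _ → d) d id

record Runs (λs : List ℕ) (P : Cmd) (σ : Env) (t : ℕ) (Post : Env → Set) : Set where
  field
    {final} : Env
    run     : Run λs P σ final t
    post    : Post final

beyond-last : ∀ l {c} → 1 ≤ c → c ≰ nth l (suc (length l))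
beyond-last l 1≤c c≤ = contradiction (subst (_ ≤_) (nth-after-last l) c≤) (<⇒≱ 1≤c)

setup-runs : ∀ {λs} → IsNonemptyPartition λs →
             Runs λs setup (initEnv λs) 3
                  (λ σ → σ 0 ≡ + length λs × DurfeeSearch.Window λs σ 1 (length λs ∸ 1))
setup-runs {λs@(a ∷ ν)} ip = record
  { run  = run-seq run-const (run-seq run-const (run-sub refl refl (s≤s z≤n)))
  ; post = refl , record
      { reg-lo = refl ; reg-width = refl ; reg-one = refl ; reg-c = refl
      ; holds = All.head (IsNonemptyPartition.positive ip)
      ; fails = beyond-last λs (s≤s z≤n) }
  }

measureArm-runs : ∀ {λs σ d} → σ 0 ≡ + length λs → σ 1 ≡ + d → σ 3 ≡ + 1 → 1 ≤ d → d ≤ nth λs d →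
                  Runs λs measureArm σ 5
                       (λ σ′ → σ′ 9 ≡ + suc (nth λs d ∸ d) × LegSearch.Window λs d σ′ d (length λs ∸ d))
measureArm-runs {λs} {d = d} at0 at1 at3 1≤d d≤λd = record
  { run  = run-seq (run-copy at1) (run-seq (run-read refl) (run-seq (run-sub refl refl d≤λd)
           (run-seq (run-add at3 refl) (run-sub at0 refl d≤r))))
  ; post = refl , record
      { reg-lo = at1 ; reg-width = refl ; reg-one = at3 ; reg-c = refl ; holds = d≤λd
      ; fails = subst (λ i → d ≰ nth λs (suc i)) (sym (m+[n∸m]≡n d≤r)) (beyond-last λs 1≤d) }
  }
  where
    d≤r = index≤length λs d 1≤d d≤λd

run-moveValue : ∀ {λs σ s t x} → σ s ≡ + suc x → update σ 13 (+ x) s ≡ σ s → σ 3 ≡ + 1 →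
                Run λs (moveValueCmd s t) σ (update (update σ 13 (+ x)) t (+ moveValue (suc x))) 3
run-moveValue {x = zero}  at-s _ at3 = run-seq (run-sub at-s at3 (s≤s z≤n)) (run-else refl run-const)
run-moveValue {x = suc x} at-s s≢13 at3 =
  run-seq (run-sub at-s at3 (s≤s z≤n)) (run-then refl (run-parity (trans s≢13 at-s)))

finish-runs : ∀ {λs σ b d A} → σ 1 ≡ + b → σ 3 ≡ + 1 → σ 6 ≡ + d → σ 9 ≡ + suc A → d ≤ b →
              Runs λs finish σ 9 (λ σ′ → σ′ 0 ≡ + hookValue (suc A) (suc (b ∸ d)))
finish-runs {b = b} {d = d} {A = A} at1 at3 at6 at9 d≤b = record
  { run  = run-seq (run-sub at1 at6 d≤b) (run-seq (run-add at3 refl)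
           (run-seq (run-moveValue at9 refl at3) (run-seq (run-moveValue refl refl at3)
           (run-mex3 (mex3ℤ-≤2 (moveValue≤2 (suc A)) leg≤2 leg≤2)))))
  ; post = refl
  }
  where
    leg≤2 = moveValue≤2 (suc (b ∸ d))

cost-bound : ∀ L {t₁ t₂} → t₁ ≤ 10 * suc L + 1 → t₂ ≤ 10 * suc L + 1 →
             3 + (t₁ + (5 + (t₂ + 9))) ≤ 39 * suc L
cost-bound L t₁≤ t₂≤ =
  ≤-trans (+-monoʳ-≤ 3 (+-mono-≤ t₁≤ (+-monoʳ-≤ 5 (+-monoˡ-≤ 9 t₂≤))))
          (≤-trans (m≤m+n _ (19 * L)) (≤-reflexive (sym (total L))))
  where
    total : ∀ L → 39 * suc L ≡ 3 + ((10 * suc L + 1) + (5 + ((10 * suc L + 1) + 9))) + 19 * L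
    total = solve-∀

sgProgram-computes : ∀ λs → IsNonemptyPartition λs →
                     Computes sgProgram λs (SG λs) (39 * suc ⌊log₂ length λs ⌋)
sgProgram-computes λs ip = Run⇒Computes
  (run-seq S.run (run-seq D.run (run-seq M.run (run-seq L.run F.run))))
  (trans F.post (cong +_ (sym SG≡hook)))
  (cost-bound ⌊log₂ length λs ⌋ D.cost L.cost)
  where
    open Frame
    K = suc ⌊log₂ length λs ⌋
    width< : ∀ i → length λs ∸ i < 2 ^ K
    width< i = ≤-<-trans (m∸n≤m (length λs) i) (n<2^suc⌊log₂n⌋ (length λs))
    module S = Runs (setup-runs ip)
    module D = DurfeeSearch.Found λs (DurfeeSearch.search-finds λs K (width< 1) (proj₂ S.post))
    d = D.lo′
    module M = Runs (measureArm-runs {λs} {D.σ′} (trans (at0 D.frame) (proj₁ S.post)) D.reg-lo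
                       (trans (at3 D.frame) (DurfeeSearch.Window.reg-one (proj₂ S.post))) D.lo≤lo′ D.holds)
    module W = LegSearch.Window λs d (proj₂ M.post)
    module L = LegSearch.Found λs d (LegSearch.search-finds λs d K (width< d) (proj₂ M.post))
    module F = Runs (finish-runs {λs} {L.σ′} L.reg-lo (trans (at3 L.frame) W.reg-one)
                       (trans (at6 L.frame) W.reg-c) (trans (at9 L.frame) (proj₁ M.post)) L.lo≤lo′)
    π = IsNonemptyPartition.positive ip , IsNonemptyPartition.decreasing ip
    SG≡hook = SG≡hookValue d L.lo′ λs π D.lo≤lo′ D.holds D.fails L.lo≤lo′ L.holds L.fails

theorem6p3 : ∃[ P ] ∃[ C ] ((λs : List ℕ) → IsNonemptyPartition λs →
    Computes P λs (SG λs) (C * suc (⌊log₂ length λs ⌋)))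
theorem6p3 = sgProgram , 39 , sgProgram-computes
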